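{- Let $J$ be a finite $4$-regular graph (multiple edges allowed) on $n$ vertices which has the triangle property and contains exactly $\frac{4n}{6}=\frac{2n}{3}$ triangles (i.e. $J$ is optimal). Then $J$ is isomorphic to the line graph of a $3$-regular triangle-free graph.
   Context: Graphs may have multiple edges. A triangle is a set of three distinct vertices with a choice of one edge joining each pair of them (so multiple edges give several triangles on the same vertex set; loops are in no triangle). A graph has the triangle property if every edge lies in at least one triangle. Every $r$-regular graph with $r$ even, on $n$ vertices, having the triangle property has at least $\frac{nr}{6}$ triangles; an $r$-regular graph with the triangle property attaining exactly this number of triangles is called optimal. -}

module Defs where

open import Data.Nat using (ℕ; zero; suc; _+_; _*_)
open import Data.Fin using (Fin; _<_; _≟_)
open import Data.Product using (Σ; _×_; _,_; proj₁; proj₂; Σ-syntax)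
open import Data.Sum using (_⊎_)
open import Data.Bool using (if_then_else_)
open import Relation.Binary.PropositionalEquality using (_≡_)
open import Relation.Nullary using (¬_; does)
open import Function.Bundles using (_↔_; Inverse)

-- A general (multi)graph: a vertex type, an edge type, and for each edge
-- its (ordered representation of its) pair of endpoints.  The order of the
-- two endpoints is irrelevant everywhere below.
record Graph : Set₁ where
  field
    V    : Set
    E    : Set
    ends : E → V × V

record FinGraph : Set where
  field
    n    : ℕ
    m    : ℕ
    ends : Fin m → Fin n × Fin n

open FinGraph public

toGraph : FinGraph → Graph
toGraph G = record { V = Fin (n G) ; E = Fin (m G) ; ends = ends G }

sumFin : ∀ {k} → (Fin k → ℕ) → ℕ
sumFin {zero}  f = 0
sumFin {suc k} f = f Fin.zero + sumFin (λ i → f (Fin.suc i))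

indic : ∀ {k} → Fin k → Fin k → ℕ
indic v w = if does (v ≟ w) then 1 else 0

-- degree: number of edge-ends at v (a loop counts twice)
degree : (G : FinGraph) → Fin (n G) → ℕ
degree G v = sumFin (λ e → indic v (proj₁ (ends G e)) + indic v (proj₂ (ends G e)))

Regular : ℕ → FinGraph → Set
Regular r G = ∀ v → degree G v ≡ r

Loopless : FinGraph → Set
Loopless G = ∀ e → ¬ (proj₁ (ends G e) ≡ proj₂ (ends G e))

Joins : (G : FinGraph) → Fin (m G) → Fin (n G) → Fin (n G) → Set
Joins G e x y = (ends G e ≡ (x , y)) ⊎ (ends G e ≡ (y , x))

-- A triangle: three distinct vertices (listed canonically a < b < c)
-- together with a choice of one edge joining each pair of them.
record Triangle (G : FinGraph) : Set where
  field
    a b c    : Fin (n G)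
    a<b      : a < b
    b<c      : b < c
    e₁ e₂ e₃ : Fin (m G)
    j₁       : Joins G e₁ a b
    j₂       : Joins G e₂ b c
    j₃       : Joins G e₃ a c

InTriangle : (G : FinGraph) → Fin (m G) → Triangle G → Set
InTriangle G e t = (e ≡ Triangle.e₁ t) ⊎ (e ≡ Triangle.e₂ t) ⊎ (e ≡ Triangle.e₃ t)

TriangleProperty : FinGraph → Set
TriangleProperty G = ∀ e → Σ (Triangle G) (InTriangle G e)

TriangleFree : FinGraph → Set
TriangleFree G = ¬ Triangle G

NumTriangles : FinGraph → ℕ → Set
NumTriangles G t = Fin t ↔ Triangle G

Incident : (G : FinGraph) → Fin (n G) → Fin (m G) → Set
Incident G w e = (proj₁ (ends G e) ≡ w) ⊎ (proj₂ (ends G e) ≡ w)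

-- Line graph (multigraph version): vertices are the edges of H; for edges
-- e ≠ f of H there is one edge between them for each common endpoint.
LineGraph : FinGraph → Graph
LineGraph H = record
  { V    = Fin (m H)
  ; E    = Σ[ e ∈ Fin (m H) ] Σ[ f ∈ Fin (m H) ] (e < f) ×
             (Σ[ w ∈ Fin (n H) ] (Incident H w e × Incident H w f))
  ; ends = λ x → proj₁ x , proj₁ (proj₂ x)
  }

SamePair : {A : Set} → A × A → A × A → Set
SamePair (x , y) (u , v) = ((x ≡ u) × (y ≡ v)) ⊎ ((x ≡ v) × (y ≡ u))

Isomorphic : Graph → Graph → Set
Isomorphic G H =
  Σ[ φ ∈ (Graph.V G ↔ Graph.V H) ] Σ[ ψ ∈ (Graph.E G ↔ Graph.E H) ]
    (∀ e → SamePair (Graph.ends H (Inverse.to ψ e))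
                    (Inverse.to φ (proj₁ (Graph.ends G e)) , Inverse.to φ (proj₂ (Graph.ends G e))))

-- Since 6t = 4n = 2m, the t triangles have exactly m = 3t edge slots; as every edge lies in some
-- triangle, every edge lies in exactly one. Counting vertex–triangle incidences through the edges
-- then puts every vertex in exactly deg/2 = 2 triangles. Let H have the triangles of J as vertices
-- and, for each vertex v of J, an edge joining the two triangles through v. H is cubic because a
-- triangle has three vertices; an edge of J amounts to its two ends together with its unique
-- triangle, i.e. to an edge of the line graph of H; and a triangle of H would give three vertices
-- of J spanning a triangle that shares an edge with one of the three, hence equals it, putting a
-- vertex of J into three triangles.

module Submission where

open import Defs
open import Data.Nat using (ℕ; zero; suc; _+_; _*_; _≤_; z≤n; s≤s)
open import Data.Nat.Properties
  using ( +-*-semiring; +-comm; +-identityʳ; *-comm; *-zeroʳ; *-identityˡ; *-identityʳ; *-distribˡ-+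
        ; *-cancelˡ-≡; *-cancelʳ-≡; suc-injective; n≤0⇒n≡0; 1+n≰n; m≤m+n; m≤n+m
        ; ≤-reflexive; ≤-trans; ≤-antisym; +-mono-≤; +-monoʳ-≤; +-cancelʳ-≤ )
open import Data.Nat.Tactic.RingSolver using (solve-∀)
open import Data.Fin as Fin using (Fin; _<_; _≟_)
import Data.Fin.Properties as Finₚ
open import Data.Product using (_×_; _,_; proj₁; proj₂; Σ-syntax)
open import Data.Sum as Sum using (_⊎_; inj₁; inj₂; [_,_])
open import Data.Empty using (⊥; ⊥-elim)
open import Function using (_∘_)
open import Function.Bundles using (_↔_; Inverse; mk↔ₛ′)
open import Function.Construct.Identity using (↔-id)
open import Axiom.UniquenessOfIdentityProofs using (module Decidable⇒UIP)
open import Relation.Nullary using (¬_; Dec; yes; no)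
open import Relation.Nullary.Decidable using (dec-true; dec-false; _⊎-dec_)
open import Relation.Binary.Definitions using (tri<; tri≈; tri>)
open import Relation.Binary.PropositionalEquality
  using (_≡_; _≢_; ≢-sym; refl; sym; trans; cong; cong₂; subst; module ≡-Reasoning)
open import Algebra.Properties.Semiring.Sum +-*-semiring
  using (sum; sum-syntax; sum-cong-≗; ∑-distrib-+; ∑-comm; *-distribˡ-sum)

sumFin≡sum : ∀ {k} (f : Fin k → ℕ) → sumFin f ≡ sum f
sumFin≡sum {zero}  f = refl
sumFin≡sum {suc k} f = cong (f Fin.zero +_) (sumFin≡sum (f ∘ Fin.suc))

sum-const : ∀ k c → ∑[ i < k ] c ≡ k * c
sum-const zero    c = refl
sum-const (suc k) c = cong (c +_) (sum-const k c)

sum-supported-at : ∀ {k} (f : Fin k → ℕ) j → (∀ i → i ≢ j → f i ≡ 0) → sum f ≡ f j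
sum-supported-at {suc k} f Fin.zero    f₀ = trans (cong (f Fin.zero +_) rest) (+-identityʳ (f Fin.zero))
  where
  rest : sum (f ∘ Fin.suc) ≡ 0
  rest = trans (sum-cong-≗ (λ i → f₀ (Fin.suc i) (λ ()))) (trans (sum-const k 0) (*-zeroʳ k))
sum-supported-at {suc k} f (Fin.suc j) f₀ =
  cong₂ _+_ (f₀ Fin.zero (λ ())) (sum-supported-at (f ∘ Fin.suc) j (λ i i≢j → f₀ (Fin.suc i) (i≢j ∘ Finₚ.suc-injective)))

≤-sum : ∀ {k} (f : Fin k → ℕ) i → f i ≤ sum f
≤-sum f Fin.zero    = m≤m+n _ _
≤-sum f (Fin.suc i) = ≤-trans (≤-sum (f ∘ Fin.suc) i) (m≤n+m _ _)

sum≡0⇒≡0 : ∀ {k} (f : Fin k → ℕ) → sum f ≡ 0 → ∀ i → f i ≡ 0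
sum≡0⇒≡0 f Σf≡0 i = n≤0⇒n≡0 (subst (f i ≤_) Σf≡0 (≤-sum f i))

sum≥card : ∀ {k} (f : Fin k → ℕ) → (∀ i → 1 ≤ f i) → k ≤ sum f
sum≥card {zero}  f f≥1 = z≤n
sum≥card {suc k} f f≥1 = +-mono-≤ (f≥1 Fin.zero) (sum≥card (f ∘ Fin.suc) (f≥1 ∘ Fin.suc))

sum≡card⇒≡1 : ∀ {k} (f : Fin k → ℕ) → (∀ i → 1 ≤ f i) → sum f ≡ k → ∀ i → f i ≡ 1
sum≡card⇒≡1 {suc k} f f≥1 Σf≡1+k = λ
  { Fin.zero    → f₀≡1
  ; (Fin.suc i) → sum≡card⇒≡1 (f ∘ Fin.suc) (f≥1 ∘ Fin.suc) rest≡k i }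
  where
  f₀+k≤1+k : f Fin.zero + k ≤ 1 + k
  f₀+k≤1+k = subst (f Fin.zero + k ≤_) Σf≡1+k (+-monoʳ-≤ (f Fin.zero) (sum≥card (f ∘ Fin.suc) (f≥1 ∘ Fin.suc)))
  f₀≡1 : f Fin.zero ≡ 1
  f₀≡1 = ≤-antisym (+-cancelʳ-≤ k _ _ f₀+k≤1+k) (f≥1 Fin.zero)
  rest≡k : sum (f ∘ Fin.suc) ≡ k
  rest≡k = suc-injective (trans (cong (_+ sum (f ∘ Fin.suc)) (sym f₀≡1)) Σf≡1+k)

sum≡1⇒unique-support : ∀ {k} (f : Fin k → ℕ) → sum f ≡ 1 →
  Σ[ i ∈ Fin k ] (f i ≡ 1 × (∀ l → 1 ≤ f l → l ≡ i))
sum≡1⇒unique-support {suc k} f Σf≡1 with f Fin.zero in f₀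
... | zero =
  let i , fi≡1 , unique = sum≡1⇒unique-support (f ∘ Fin.suc) Σf≡1 in
  Fin.suc i , fi≡1 , λ
    { Fin.zero    1≤f₀ → ⊥-elim (1+n≰n (subst (1 ≤_) f₀ 1≤f₀))
    ; (Fin.suc l) 1≤fl → cong Fin.suc (unique l 1≤fl) }
... | suc zero = Fin.zero , f₀ , λ
    { Fin.zero    _    → refl
    ; (Fin.suc l) 1≤fl → ⊥-elim (1+n≰n (subst (1 ≤_) (sum≡0⇒≡0 (f ∘ Fin.suc) (suc-injective Σf≡1) l) 1≤fl)) }

record PairSupport {k} (f : Fin k → ℕ) : Set where
  field
    lo hi   : Fin k
    lo<hi   : lo < hi
    f-lo    : f lo ≡ 1
    f-hi    : f hi ≡ 1
    support : ∀ l → 1 ≤ f l → l ≡ lo ⊎ l ≡ hi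

sum≡2⇒pair-support : ∀ {k} (f : Fin k → ℕ) → (∀ i → f i ≤ 1) → sum f ≡ 2 → PairSupport f
sum≡2⇒pair-support {suc k} f f≤1 Σf≡2 with f Fin.zero in f₀
... | zero = record
  { lo<hi = s≤s lo<hi ; f-lo = f-lo ; f-hi = f-hi
  ; support = λ
      { Fin.zero    1≤f₀ → ⊥-elim (1+n≰n (subst (1 ≤_) f₀ 1≤f₀))
      ; (Fin.suc l) 1≤fl → Sum.map (cong Fin.suc) (cong Fin.suc) (support l 1≤fl) } }
  where open PairSupport (sum≡2⇒pair-support (f ∘ Fin.suc) (f≤1 ∘ Fin.suc) Σf≡2)
... | suc zero =
  let j , fj≡1 , unique = sum≡1⇒unique-support (f ∘ Fin.suc) (suc-injective Σf≡2) in record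
  { lo<hi = s≤s {0} z≤n ; f-lo = f₀ ; f-hi = fj≡1
  ; support = λ
      { Fin.zero    _    → inj₁ refl
      ; (Fin.suc l) 1≤fl → inj₂ (cong Fin.suc (unique l 1≤fl)) } }
... | suc (suc _) with s≤s () ← subst (_≤ 1) f₀ (f≤1 Fin.zero)

indic-refl : ∀ {k} (v : Fin k) → indic v v ≡ 1
indic-refl v rewrite dec-true (v ≟ v) refl = refl

indic-≢ : ∀ {k} {v w : Fin k} → v ≢ w → indic v w ≡ 0
indic-≢ {v = v} {w} v≢w rewrite dec-false (v ≟ w) v≢w = refl

∑-*-indic : ∀ {k} (g : Fin k → ℕ) j → ∑[ i < k ] (g i * indic i j) ≡ g j
∑-*-indic g j = begin
  ∑[ i < _ ] (g i * indic i j) ≡⟨ sum-supported-at _ j (λ i i≢j → trans (cong (g i *_) (indic-≢ i≢j)) (*-zeroʳ (g i))) ⟩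
  g j * indic j j              ≡⟨ cong (g j *_) (indic-refl j) ⟩
  g j * 1                      ≡⟨ *-identityʳ (g j) ⟩
  g j                          ∎
  where open ≡-Reasoning

∑-indic : ∀ {k} (j : Fin k) → ∑[ i < k ] indic i j ≡ 1
∑-indic j = trans (sum-supported-at _ j (λ _ → indic-≢)) (indic-refl j)

∑-*-indic₃ : ∀ {k} (g : Fin k → ℕ) x y z →
  ∑[ i < k ] (g i * (indic i x + indic i y + indic i z)) ≡ g x + g y + g z
∑-*-indic₃ g x y z = begin
  ∑[ i < _ ] (g i * (indic i x + indic i y + indic i z))
    ≡⟨ sum-cong-≗ (λ i → trans (*-distribˡ-+ (g i) _ _) (cong (_+ g i * indic i z) (*-distribˡ-+ (g i) _ _))) ⟩
  ∑[ i < _ ] (g i * indic i x + g i * indic i y + g i * indic i z)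
    ≡⟨ trans (∑-distrib-+ (λ i → g i * indic i x + g i * indic i y) (λ i → g i * indic i z))
             (cong (_+ _) (∑-distrib-+ (λ i → g i * indic i x) (λ i → g i * indic i y))) ⟩
  ∑[ i < _ ] (g i * indic i x) + ∑[ i < _ ] (g i * indic i y) + ∑[ i < _ ] (g i * indic i z)
    ≡⟨ cong₂ _+_ (cong₂ _+_ (∑-*-indic g x) (∑-*-indic g y)) (∑-*-indic g z) ⟩
  g x + g y + g z
    ∎
  where open ≡-Reasoning

∑-indic₃ : ∀ {k} (x y z : Fin k) → ∑[ i < k ] (indic i x + indic i y + indic i z) ≡ 3
∑-indic₃ x y z = trans (sum-cong-≗ {y = λ i → 1 * (indic i x + indic i y + indic i z)} (λ i → sym (*-identityˡ _)))
                       (∑-*-indic₃ (λ _ → 1) x y z)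

module _ {A : Set} where

  SamePair-trans : {p q r : A × A} → SamePair p q → SamePair q r → SamePair p r
  SamePair-trans {_ , _} {_ , _} {_ , _} (inj₁ (refl , refl)) q≈r = q≈r
  SamePair-trans {_ , _} {_ , _} {_ , _} (inj₂ (refl , refl)) (inj₁ (refl , refl)) = inj₂ (refl , refl)
  SamePair-trans {_ , _} {_ , _} {_ , _} (inj₂ (refl , refl)) (inj₂ (refl , refl)) = inj₁ (refl , refl)

  SamePair-∈ : ∀ {x y u v : A} → SamePair (x , y) (u , v) → (x ≡ u ⊎ x ≡ v) × (y ≡ u ⊎ y ≡ v)
  SamePair-∈ (inj₁ (refl , refl)) = inj₁ refl , inj₂ refl
  SamePair-∈ (inj₂ (refl , refl)) = inj₂ refl , inj₁ refl

SamePair-sorted : ∀ {k} {u v u′ v′ : Fin k} → u < v → u′ < v′ → SamePair (u , v) (u′ , v′) → u ≡ u′ × v ≡ v′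
SamePair-sorted _   _     (inj₁ eq)            = eq
SamePair-sorted u<v u′<v′ (inj₂ (refl , refl)) = ⊥-elim (Finₚ.<-asym u<v u′<v′)

module TriangleGeometry (G : FinGraph) where

  Vertex Edge : Set
  Vertex = Fin (n G)
  Edge   = Fin (m G)

  open Triangle

  infix 4 _∈ᵛ_
  _∈ᵛ_ : Vertex → Triangle G → Set
  v ∈ᵛ T = v ≡ a T ⊎ v ≡ b T ⊎ v ≡ c T

  Side : Triangle G → Vertex → Vertex → Set
  Side T u v = u ∈ᵛ T × v ∈ᵛ T × u ≢ v

  Joins-sym : ∀ {e x y} → Joins G e x y → Joins G e y x
  Joins-sym = Sum.swap

  Joins-SamePair : ∀ {e x y u v} → Joins G e x y → SamePair (x , y) (u , v) → Joins G e u v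
  Joins-SamePair j (inj₁ (refl , refl)) = j
  Joins-SamePair j (inj₂ (refl , refl)) = Joins-sym j

  Joins⇒SamePair : ∀ {e x y u v} → Joins G e x y → Joins G e u v → SamePair (x , y) (u , v)
  Joins⇒SamePair (inj₁ refl) (inj₁ refl) = inj₁ (refl , refl)
  Joins⇒SamePair (inj₁ refl) (inj₂ refl) = inj₂ (refl , refl)
  Joins⇒SamePair (inj₂ refl) (inj₁ refl) = inj₂ (refl , refl)
  Joins⇒SamePair (inj₂ refl) (inj₂ refl) = inj₁ (refl , refl)

  shared-ends⇒SamePair : ∀ {e f u v p q r s} → Joins G e u v → Joins G f u v →
                         Joins G e p q → Joins G f r s → SamePair (p , q) (r , s)
  shared-ends⇒SamePair je jf jp jr = SamePair-trans (Joins⇒SamePair jp je) (Joins⇒SamePair jf jr)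

  module _ (T : Triangle G) where

    a≢b : a T ≢ b T
    a≢b = Finₚ.<⇒≢ (a<b T)

    b≢c : b T ≢ c T
    b≢c = Finₚ.<⇒≢ (b<c T)

    a≢c : a T ≢ c T
    a≢c = Finₚ.<⇒≢ (Finₚ.<-trans (a<b T) (b<c T))

    triangle-edge : ∀ {u v} → Side T u v → Σ[ e ∈ Edge ] (InTriangle G e T × Joins G e u v)
    triangle-edge (inj₁ refl        , inj₂ (inj₁ refl) , _  ) = e₁ T , inj₁ refl , j₁ T
    triangle-edge (inj₁ refl        , inj₂ (inj₂ refl) , _  ) = e₃ T , inj₂ (inj₂ refl) , j₃ T
    triangle-edge (inj₂ (inj₁ refl) , inj₁ refl        , _  ) = e₁ T , inj₁ refl , Joins-sym (j₁ T)
    triangle-edge (inj₂ (inj₁ refl) , inj₂ (inj₂ refl) , _  ) = e₂ T , inj₂ (inj₁ refl) , j₂ T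
    triangle-edge (inj₂ (inj₂ refl) , inj₁ refl        , _  ) = e₃ T , inj₂ (inj₂ refl) , Joins-sym (j₃ T)
    triangle-edge (inj₂ (inj₂ refl) , inj₂ (inj₁ refl) , _  ) = e₂ T , inj₂ (inj₁ refl) , Joins-sym (j₂ T)
    triangle-edge (inj₁ refl        , inj₁ refl        , u≢v) = ⊥-elim (u≢v refl)
    triangle-edge (inj₂ (inj₁ refl) , inj₂ (inj₁ refl) , u≢v) = ⊥-elim (u≢v refl)
    triangle-edge (inj₂ (inj₂ refl) , inj₂ (inj₂ refl) , u≢v) = ⊥-elim (u≢v refl)

    side-ends : ∀ {u v p q} → SamePair (u , v) (p , q) → p ∈ᵛ T → q ∈ᵛ T → p ≢ q → Side T u v
    side-ends (inj₁ (refl , refl)) p∈T q∈T p≢q = p∈T , q∈T , p≢q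
    side-ends (inj₂ (refl , refl)) p∈T q∈T p≢q = q∈T , p∈T , ≢-sym p≢q

    triangle-edge-ends : ∀ {e u v} → InTriangle G e T → Joins G e u v → Side T u v
    triangle-edge-ends (inj₁ refl)        j = side-ends (Joins⇒SamePair j (j₁ T)) (inj₁ refl) (inj₂ (inj₁ refl)) a≢b
    triangle-edge-ends (inj₂ (inj₁ refl)) j = side-ends (Joins⇒SamePair j (j₂ T)) (inj₂ (inj₁ refl)) (inj₂ (inj₂ refl)) b≢c
    triangle-edge-ends (inj₂ (inj₂ refl)) j = side-ends (Joins⇒SamePair j (j₃ T)) (inj₁ refl) (inj₂ (inj₂ refl)) a≢c

    -- The sides {a,b}, {b,c}, {a,c} of T are pairwise distinct pairs.
    triangle-edge-unique : ∀ {e f u v} → InTriangle G e T → InTriangle G f T → Joins G e u v → Joins G f u v → e ≡ f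
    triangle-edge-unique (inj₁ refl)        (inj₁ refl)        _  _  = refl
    triangle-edge-unique (inj₂ (inj₁ refl)) (inj₂ (inj₁ refl)) _  _  = refl
    triangle-edge-unique (inj₂ (inj₂ refl)) (inj₂ (inj₂ refl)) _  _  = refl
    triangle-edge-unique (inj₁ refl)        (inj₂ (inj₁ refl)) je jf =
      ⊥-elim ([ a≢b , a≢c ] (proj₁ (SamePair-∈ (shared-ends⇒SamePair je jf (j₁ T) (j₂ T)))))
    triangle-edge-unique (inj₁ refl)        (inj₂ (inj₂ refl)) je jf =
      ⊥-elim ([ ≢-sym a≢b , b≢c ] (proj₂ (SamePair-∈ (shared-ends⇒SamePair je jf (j₁ T) (j₃ T)))))
    triangle-edge-unique (inj₂ (inj₁ refl)) (inj₂ (inj₂ refl)) je jf =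
      ⊥-elim ([ ≢-sym a≢b , b≢c ] (proj₁ (SamePair-∈ (shared-ends⇒SamePair je jf (j₂ T) (j₃ T)))))
    triangle-edge-unique e∈T@(inj₂ (inj₁ refl)) f∈T@(inj₁ refl)        je jf = sym (triangle-edge-unique f∈T e∈T jf je)
    triangle-edge-unique e∈T@(inj₂ (inj₂ refl)) f∈T@(inj₁ refl)        je jf = sym (triangle-edge-unique f∈T e∈T jf je)
    triangle-edge-unique e∈T@(inj₂ (inj₂ refl)) f∈T@(inj₂ (inj₁ refl)) je jf = sym (triangle-edge-unique f∈T e∈T jf je)

  private
    triangle-through-< : ∀ {x y z exy eyz exz} → x < y → y ≢ z → x ≢ z →
      Joins G exy x y → Joins G eyz y z → Joins G exz x z → Σ[ T ∈ Triangle G ] (InTriangle G exy T × z ∈ᵛ T)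
    triangle-through-< {x} {y} {z} x<y y≢z x≢z jxy jyz jxz with Finₚ.<-cmp y z
    ... | tri< y<z _ _ = record { a<b = x<y ; b<c = y<z ; j₁ = jxy ; j₂ = jyz ; j₃ = jxz } , inj₁ refl , inj₂ (inj₂ refl)
    ... | tri≈ _ y≡z _ = ⊥-elim (y≢z y≡z)
    ... | tri> _ _ z<y with Finₚ.<-cmp x z
    ...   | tri< x<z _ _ = record { a<b = x<z ; b<c = z<y ; j₁ = jxz ; j₂ = Joins-sym jyz ; j₃ = jxy } , inj₂ (inj₂ refl) , inj₂ (inj₁ refl)
    ...   | tri≈ _ x≡z _ = ⊥-elim (x≢z x≡z)
    ...   | tri> _ _ z<x = record { a<b = z<x ; b<c = x<y ; j₁ = Joins-sym jxz ; j₂ = jxy ; j₃ = Joins-sym jyz } , inj₂ (inj₁ refl) , inj₁ refl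

  triangle-through : ∀ {x y z exy eyz exz} → x ≢ y → y ≢ z → x ≢ z →
    Joins G exy x y → Joins G eyz y z → Joins G exz x z → Σ[ T ∈ Triangle G ] (InTriangle G exy T × z ∈ᵛ T)
  triangle-through {x} {y} x≢y y≢z x≢z jxy jyz jxz with Finₚ.<-cmp x y
  ... | tri< x<y _ _ = triangle-through-< x<y y≢z x≢z jxy jyz jxz
  ... | tri≈ _ x≡y _ = ⊥-elim (x≢y x≡y)
  ... | tri> _ _ y<x = triangle-through-< y<x x≢z y≢z (Joins-sym jxy) jxz jyz

module Incidences (G : FinGraph) where

  open TriangleGeometry G
  open Triangle

  incidence : Vertex → Edge → ℕ
  incidence v e = indic v (proj₁ (ends G e)) + indic v (proj₂ (ends G e))

  edgeIncidence : Edge → Triangle G → ℕ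
  edgeIncidence e T = indic e (e₁ T) + indic e (e₂ T) + indic e (e₃ T)

  vertexIncidence : Vertex → Triangle G → ℕ
  vertexIncidence v T = indic v (a T) + indic v (b T) + indic v (c T)

  handshake : ∑[ v < n G ] degree G v ≡ m G * 2
  handshake = begin
    ∑[ v < n G ] degree G v                ≡⟨ sum-cong-≗ (λ v → sumFin≡sum (incidence v)) ⟩
    ∑[ v < n G ] ∑[ e < m G ] incidence v e ≡⟨ ∑-comm incidence ⟩
    ∑[ e < m G ] ∑[ v < n G ] incidence v e ≡⟨ sum-cong-≗ ends-counted-twice ⟩
    ∑[ e < m G ] 2                         ≡⟨ sum-const (m G) 2 ⟩
    m G * 2                                ∎
    where
    open ≡-Reasoning
    ends-counted-twice : ∀ e → ∑[ v < n G ] incidence v e ≡ 2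
    ends-counted-twice e = trans (∑-distrib-+ (λ v → indic v (proj₁ (ends G e))) (λ v → indic v (proj₂ (ends G e))))
                                 (cong₂ _+_ (∑-indic (proj₁ (ends G e))) (∑-indic (proj₂ (ends G e))))

  regular⇒edges : ∀ {r} → Regular r G → m G * 2 ≡ n G * r
  regular⇒edges {r} reg = trans (sym handshake) (trans (sum-cong-≗ reg) (sum-const (n G) r))

  ∑-edgeIncidence : ∀ T → ∑[ e < m G ] edgeIncidence e T ≡ 3
  ∑-edgeIncidence T = ∑-indic₃ (e₁ T) (e₂ T) (e₃ T)

  ∑-vertexIncidence : ∀ T → ∑[ v < n G ] vertexIncidence v T ≡ 3
  ∑-vertexIncidence T = ∑-indic₃ (a T) (b T) (c T)

  edgeIncidence-pos : ∀ {e T} → InTriangle G e T → 1 ≤ edgeIncidence e T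
  edgeIncidence-pos {e}     (inj₁ refl)        rewrite indic-refl e = s≤s z≤n
  edgeIncidence-pos {e} {T} (inj₂ (inj₁ refl)) rewrite indic-refl e = ≤-trans (m≤n+m 1 (indic e (e₁ T))) (m≤m+n _ _)
  edgeIncidence-pos {e}     (inj₂ (inj₂ refl)) rewrite indic-refl e = m≤n+m 1 _

  infix 4 _∈ᵛ?_
  _∈ᵛ?_ : ∀ v T → Dec (v ∈ᵛ T)
  v ∈ᵛ? T = v ≟ a T ⊎-dec v ≟ b T ⊎-dec v ≟ c T

  vertexIncidence-∈ : ∀ {v T} → v ∈ᵛ T → vertexIncidence v T ≡ 1
  vertexIncidence-∈ {T = T} (inj₁ refl)
    rewrite indic-refl (a T) | indic-≢ (a≢b T) | indic-≢ (a≢c T) = refl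
  vertexIncidence-∈ {T = T} (inj₂ (inj₁ refl))
    rewrite indic-≢ (≢-sym (a≢b T)) | indic-refl (b T) | indic-≢ (b≢c T) = refl
  vertexIncidence-∈ {T = T} (inj₂ (inj₂ refl))
    rewrite indic-≢ (≢-sym (a≢c T)) | indic-≢ (≢-sym (b≢c T)) | indic-refl (c T) = refl

  vertexIncidence-∉ : ∀ {v T} → ¬ v ∈ᵛ T → vertexIncidence v T ≡ 0
  vertexIncidence-∉ v∉T
    rewrite indic-≢ (v∉T ∘ inj₁) | indic-≢ (v∉T ∘ inj₂ ∘ inj₁) | indic-≢ (v∉T ∘ inj₂ ∘ inj₂) = refl

  vertexIncidence≤1 : ∀ v T → vertexIncidence v T ≤ 1
  vertexIncidence≤1 v T with v ∈ᵛ? T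
  ... | yes v∈T = ≤-reflexive (vertexIncidence-∈ {T = T} v∈T)
  ... | no  v∉T = subst (_≤ 1) (sym (vertexIncidence-∉ {T = T} v∉T)) z≤n

  vertexIncidence≡1⇒∈ : ∀ {v T} → vertexIncidence v T ≡ 1 → v ∈ᵛ T
  vertexIncidence≡1⇒∈ {v} {T} incidence≡1 with v ∈ᵛ? T
  ... | yes v∈T = v∈T
  ... | no  v∉T with () ← trans (sym incidence≡1) (vertexIncidence-∉ {T = T} v∉T)

  incidence-Joins : ∀ v {e x y} → Joins G e x y → incidence v e ≡ indic v x + indic v y
  incidence-Joins v (inj₁ refl) = refl
  incidence-Joins v (inj₂ refl) = +-comm (indic v _) (indic v _)

  -- Each vertex of T is an end of exactly two of its edges.
  ∑-incidence*edgeIncidence : ∀ v T → ∑[ e < m G ] (incidence v e * edgeIncidence e T) ≡ 2 * vertexIncidence v T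
  ∑-incidence*edgeIncidence v T = begin
    ∑[ e < m G ] (incidence v e * edgeIncidence e T)
      ≡⟨ ∑-*-indic₃ (incidence v) (e₁ T) (e₂ T) (e₃ T) ⟩
    incidence v (e₁ T) + incidence v (e₂ T) + incidence v (e₃ T)
      ≡⟨ cong₂ _+_ (cong₂ _+_ (incidence-Joins v (j₁ T)) (incidence-Joins v (j₂ T))) (incidence-Joins v (j₃ T)) ⟩
    (α + β) + (β + γ) + (α + γ)
      ≡⟨ sides-twice α β γ ⟩
    2 * (α + β + γ)
      ∎
    where
    open ≡-Reasoning
    α = indic v (a T)
    β = indic v (b T)
    γ = indic v (c T)
    sides-twice : ∀ α β γ → (α + β) + (β + γ) + (α + γ) ≡ 2 * (α + β + γ)
    sides-twice = solve-∀

module TriangleCounts (G : FinGraph) {t : ℕ} (enum : Fin t ↔ Triangle G) where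

  open TriangleGeometry G
  open Incidences G

  tri : Fin t → Triangle G
  tri = Inverse.to enum

  index : Triangle G → Fin t
  index = Inverse.from enum

  tri-index : ∀ T → tri (index T) ≡ T
  tri-index = Inverse.strictlyInverseˡ enum

  triangleCount : Edge → ℕ
  triangleCount e = ∑[ i < t ] edgeIncidence e (tri i)

  vertexTriangleCount : Vertex → ℕ
  vertexTriangleCount v = ∑[ i < t ] vertexIncidence v (tri i)

  ∑-triangleCount : ∑[ e < m G ] triangleCount e ≡ t * 3
  ∑-triangleCount = begin
    ∑[ e < m G ] ∑[ i < t ] edgeIncidence e (tri i) ≡⟨ ∑-comm (λ e i → edgeIncidence e (tri i)) ⟩
    ∑[ i < t ] ∑[ e < m G ] edgeIncidence e (tri i) ≡⟨ sum-cong-≗ (∑-edgeIncidence ∘ tri) ⟩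
    ∑[ i < t ] 3                                    ≡⟨ sum-const t 3 ⟩
    t * 3                                           ∎
    where open ≡-Reasoning

  2*vertexTriangleCount : ∀ v → 2 * vertexTriangleCount v ≡ ∑[ e < m G ] (incidence v e * triangleCount e)
  2*vertexTriangleCount v = begin
    2 * ∑[ i < t ] vertexIncidence v (tri i)
      ≡⟨ *-distribˡ-sum 2 (λ i → vertexIncidence v (tri i)) ⟩
    ∑[ i < t ] (2 * vertexIncidence v (tri i))
      ≡⟨ sum-cong-≗ (λ i → sym (∑-incidence*edgeIncidence v (tri i))) ⟩
    ∑[ i < t ] ∑[ e < m G ] (incidence v e * edgeIncidence e (tri i))
      ≡⟨ ∑-comm (λ i e → incidence v e * edgeIncidence e (tri i)) ⟩
    ∑[ e < m G ] ∑[ i < t ] (incidence v e * edgeIncidence e (tri i))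
      ≡⟨ sum-cong-≗ (λ e → sym (*-distribˡ-sum (incidence v e) (λ i → edgeIncidence e (tri i)))) ⟩
    ∑[ e < m G ] (incidence v e * triangleCount e)
      ∎
    where open ≡-Reasoning

  edgeIncidence-index-pos : ∀ {e T} → InTriangle G e T → 1 ≤ edgeIncidence e (tri (index T))
  edgeIncidence-index-pos {e} {T} e∈T = edgeIncidence-pos {T = tri (index T)} (subst (InTriangle G e) (sym (tri-index T)) e∈T)

  triangleCount-pos : TriangleProperty G → ∀ e → 1 ≤ triangleCount e
  triangleCount-pos tp e =
    ≤-trans (edgeIncidence-index-pos (proj₂ (tp e))) (≤-sum (λ i → edgeIncidence e (tri i)) (index (proj₁ (tp e))))

  triangleCount≡1⇒unique : ∀ {e T T′} → triangleCount e ≡ 1 → InTriangle G e T → InTriangle G e T′ → T ≡ T′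
  triangleCount≡1⇒unique {e} {T} {T′} count≡1 e∈T e∈T′ = begin
    T                ≡⟨ sym (tri-index T) ⟩
    tri (index T)    ≡⟨ cong tri (trans (unique _ (edgeIncidence-index-pos e∈T)) (sym (unique _ (edgeIncidence-index-pos e∈T′)))) ⟩
    tri (index T′)   ≡⟨ tri-index T′ ⟩
    T′               ∎
    where
    open ≡-Reasoning
    unique = proj₂ (proj₂ (sum≡1⇒unique-support (λ i → edgeIncidence e (tri i)) count≡1))

  -- m = nr/2 = 3t: the triangles have exactly one edge slot per edge.
  optimal⇒triangleCount≡1 : ∀ {r} → Regular r G → TriangleProperty G → 6 * t ≡ r * n G → ∀ e → triangleCount e ≡ 1
  optimal⇒triangleCount≡1 {r} reg tp 6t≡rn = sum≡card⇒≡1 triangleCount (triangleCount-pos tp) (trans ∑-triangleCount (sym m≡t*3))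
    where
    m≡t*3 : m G ≡ t * 3
    m≡t*3 = *-cancelʳ-≡ (m G) (t * 3) 2 (begin
      m G * 2     ≡⟨ regular⇒edges reg ⟩
      n G * r     ≡⟨ *-comm (n G) r ⟩
      r * n G     ≡⟨ sym 6t≡rn ⟩
      6 * t       ≡⟨ 6t≡t*3*2 t ⟩
      t * 3 * 2   ∎)
      where
      open ≡-Reasoning
      6t≡t*3*2 : ∀ t → 6 * t ≡ t * 3 * 2
      6t≡t*3*2 = solve-∀

  triangleCount≡1⇒2*vertexTriangleCount≡degree : (∀ e → triangleCount e ≡ 1) → ∀ v → 2 * vertexTriangleCount v ≡ degree G v
  triangleCount≡1⇒2*vertexTriangleCount≡degree count≡1 v = begin
    2 * vertexTriangleCount v                     ≡⟨ 2*vertexTriangleCount v ⟩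
    ∑[ e < m G ] (incidence v e * triangleCount e) ≡⟨ sum-cong-≗ (λ e → trans (cong (incidence v e *_) (count≡1 e)) (*-identityʳ _)) ⟩
    ∑[ e < m G ] incidence v e                     ≡⟨ sym (sumFin≡sum (incidence v)) ⟩
    degree G v                                     ∎
    where open ≡-Reasoning

module TriangleLineGraph
  (J : FinGraph) {t : ℕ} (enum : Fin t ↔ Triangle J) (tp : TriangleProperty J)
  (edge-once : ∀ e → TriangleCounts.triangleCount J enum e ≡ 1)
  (vertex-twice : ∀ v → TriangleCounts.vertexTriangleCount J enum v ≡ 2)
  where

  open TriangleGeometry J
  open Incidences J
  open TriangleCounts J enum

  edge-unique : ∀ {e T T′} → InTriangle J e T → InTriangle J e T′ → T ≡ T′
  edge-unique {e} = triangleCount≡1⇒unique (edge-once e)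

  private
    triangle-pair : ∀ v → PairSupport (λ i → vertexIncidence v (tri i))
    triangle-pair v = sum≡2⇒pair-support _ (λ i → vertexIncidence≤1 v (tri i)) (vertex-twice v)
    module TP v = PairSupport (triangle-pair v)

  first second : Vertex → Fin t
  first  v = TP.lo v
  second v = TP.hi v

  first<second : ∀ v → first v < second v
  first<second = TP.lo<hi

  ∈-first : ∀ v → v ∈ᵛ tri (first v)
  ∈-first v = vertexIncidence≡1⇒∈ {T = tri (first v)} (TP.f-lo v)

  ∈-second : ∀ v → v ∈ᵛ tri (second v)
  ∈-second v = vertexIncidence≡1⇒∈ {T = tri (second v)} (TP.f-hi v)

  ∈⇒first-or-second : ∀ {v w} → v ∈ᵛ tri w → w ≡ first v ⊎ w ≡ second v
  ∈⇒first-or-second {v} {w} v∈w = TP.support v w (≤-reflexive (sym (vertexIncidence-∈ {T = tri w} v∈w)))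

  H : FinGraph
  H = record { n = t ; m = n J ; ends = λ v → first v , second v }

  H-loopless : Loopless H
  H-loopless v = Finₚ.<⇒≢ (first<second v)

  incident⇒∈ : ∀ {w v} → Incident H w v → v ∈ᵛ tri w
  incident⇒∈ (inj₁ refl) = ∈-first _
  incident⇒∈ (inj₂ refl) = ∈-second _

  ∈⇒incident : ∀ {w v} → v ∈ᵛ tri w → Incident H w v
  ∈⇒incident v∈w = Sum.map sym sym (∈⇒first-or-second v∈w)

  H-incidence : ∀ w v → Incidences.incidence H w v ≡ vertexIncidence v (tri w)
  H-incidence w v with v ∈ᵛ? tri w
  ... | no v∉w = begin
    indic w (first v) + indic w (second v) ≡⟨ cong₂ _+_ (indic-≢ (v∉w ∘ incident⇒∈ ∘ inj₁ ∘ sym)) (indic-≢ (v∉w ∘ incident⇒∈ ∘ inj₂ ∘ sym)) ⟩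
    0                                      ≡⟨ sym (vertexIncidence-∉ {T = tri w} v∉w) ⟩
    vertexIncidence v (tri w)              ∎
    where open ≡-Reasoning
  ... | yes v∈w = trans (one-of-two (∈⇒first-or-second v∈w)) (sym (vertexIncidence-∈ {T = tri w} v∈w))
    where
    one-of-two : w ≡ first v ⊎ w ≡ second v → indic w (first v) + indic w (second v) ≡ 1
    one-of-two (inj₁ refl) rewrite indic-refl w | indic-≢ (Finₚ.<⇒≢ (first<second v)) = refl
    one-of-two (inj₂ refl) rewrite indic-refl w | indic-≢ (≢-sym (Finₚ.<⇒≢ (first<second v))) = refl

  H-cubic : Regular 3 H
  H-cubic w = begin
    degree H w                                ≡⟨ sumFin≡sum (Incidences.incidence H w) ⟩
    ∑[ v < n J ] Incidences.incidence H w v   ≡⟨ sum-cong-≗ (H-incidence w) ⟩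
    ∑[ v < n J ] vertexIncidence v (tri w)    ≡⟨ ∑-vertexIncidence (tri w) ⟩
    3                                         ∎
    where open ≡-Reasoning

  Joins⇒∈ : ∀ {v p q} → Joins H v p q → v ∈ᵛ tri p × v ∈ᵛ tri q
  Joins⇒∈ (inj₁ refl) = ∈-first _ , ∈-second _
  Joins⇒∈ (inj₂ refl) = ∈-second _ , ∈-first _

  not-in-three : ∀ {v p q r} → p < q → q < r → v ∈ᵛ tri p → v ∈ᵛ tri q → v ∈ᵛ tri r → ⊥
  not-in-three p<q q<r v∈p v∈q v∈r
    with ∈⇒first-or-second v∈p | ∈⇒first-or-second v∈q | ∈⇒first-or-second v∈r
  ... | inj₁ refl | inj₁ q≡ | _         = Finₚ.<⇒≢ p<q (sym q≡)
  ... | inj₂ refl | inj₂ q≡ | _         = Finₚ.<⇒≢ p<q (sym q≡)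
  ... | _         | inj₁ refl | inj₁ r≡ = Finₚ.<⇒≢ q<r (sym r≡)
  ... | _         | inj₂ refl | inj₂ r≡ = Finₚ.<⇒≢ q<r (sym r≡)
  ... | inj₁ refl | inj₂ _  | inj₁ r≡   = Finₚ.<⇒≢ (Finₚ.<-trans p<q q<r) (sym r≡)
  ... | inj₂ refl | inj₁ _  | inj₂ r≡   = Finₚ.<⇒≢ (Finₚ.<-trans p<q q<r) (sym r≡)

  -- x, y, z span a triangle of J through the edge of tri B joining x and y, so it is tri B and z lies in A, B and C.
  H-triangleFree : TriangleFree H
  H-triangleFree T = not-in-three A<B B<C z∈A z∈B z∈C
    where
    open Triangle T renaming (a to A; b to B; c to C; a<b to A<B; b<c to B<C; e₁ to x; e₂ to y; e₃ to z)
    x∈A = proj₁ (Joins⇒∈ j₁)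
    x∈B = proj₂ (Joins⇒∈ j₁)
    y∈B = proj₁ (Joins⇒∈ j₂)
    y∈C = proj₂ (Joins⇒∈ j₂)
    z∈A = proj₁ (Joins⇒∈ j₃)
    z∈C = proj₂ (Joins⇒∈ j₃)
    x≢y : x ≢ y
    x≢y refl = not-in-three A<B B<C x∈A x∈B y∈C
    y≢z : y ≢ z
    y≢z refl = not-in-three A<B B<C z∈A y∈B y∈C
    x≢z : x ≢ z
    x≢z refl = not-in-three A<B B<C x∈A x∈B z∈C
    exy = triangle-edge (tri B) (x∈B , y∈B , x≢y)
    eyz = triangle-edge (tri C) (y∈C , z∈C , y≢z)
    exz = triangle-edge (tri A) (x∈A , z∈A , x≢z)
    T′ = triangle-through x≢y y≢z x≢z (proj₂ (proj₂ exy)) (proj₂ (proj₂ eyz)) (proj₂ (proj₂ exz))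
    z∈B : z ∈ᵛ tri B
    z∈B = subst (z ∈ᵛ_) (edge-unique {T = proj₁ T′} {T′ = tri B} (proj₁ (proj₂ T′)) (proj₁ (proj₂ exy))) (proj₂ (proj₂ T′))

  LineEdge : Set
  LineEdge = Graph.E (LineGraph H)

  lineEnds : LineEdge → Vertex × Vertex
  lineEnds = Graph.ends (LineGraph H)

  lineTriangle : LineEdge → Fin t
  lineTriangle (_ , _ , _ , w , _) = w

  lineEnds-sorted : ∀ r → proj₁ (lineEnds r) < proj₂ (lineEnds r)
  lineEnds-sorted (_ , _ , u<v , _) = u<v

  lineSide : ∀ r → Side (tri (lineTriangle r)) (proj₁ (lineEnds r)) (proj₂ (lineEnds r))
  lineSide (_ , _ , u<v , _ , u∈w , v∈w) = incident⇒∈ u∈w , incident⇒∈ v∈w , Finₚ.<⇒≢ u<v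

  -- Edges of LineGraph H carry incidence proofs; as first v ≢ second v these are unique.
  Incident-irrelevant : ∀ {w v} (p q : Incident H w v) → p ≡ q
  Incident-irrelevant (inj₁ p) (inj₁ q) = cong inj₁ (Decidable⇒UIP.≡-irrelevant _≟_ p q)
  Incident-irrelevant (inj₂ p) (inj₂ q) = cong inj₂ (Decidable⇒UIP.≡-irrelevant _≟_ p q)
  Incident-irrelevant {v = v} (inj₁ p) (inj₂ q) = ⊥-elim (Finₚ.<⇒≢ (first<second v) (trans p (sym q)))
  Incident-irrelevant {v = v} (inj₂ p) (inj₁ q) = ⊥-elim (Finₚ.<⇒≢ (first<second v) (trans q (sym p)))

  LineEdge-ext : ∀ {r s} → lineEnds r ≡ lineEnds s → lineTriangle r ≡ lineTriangle s → r ≡ s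
  LineEdge-ext {u , v , u<v , w , u∈w , v∈w} {_ , _ , u<v′ , _ , u∈w′ , v∈w′} refl refl
    rewrite Finₚ.<-irrelevant u<v u<v′ | Incident-irrelevant u∈w u∈w′ | Incident-irrelevant v∈w v∈w′ = refl

  lineEdge : ∀ {w u v} → Side (tri w) u v → LineEdge
  lineEdge {w} {u} {v} (u∈w , v∈w , u≢v) with Finₚ.<-cmp u v
  ... | tri< u<v _ _ = u , v , u<v , w , ∈⇒incident u∈w , ∈⇒incident v∈w
  ... | tri≈ _ u≡v _ = ⊥-elim (u≢v u≡v)
  ... | tri> _ _ v<u = v , u , v<u , w , ∈⇒incident v∈w , ∈⇒incident u∈w

  lineEdge-ends : ∀ {w u v} (side : Side (tri w) u v) → SamePair (lineEnds (lineEdge side)) (u , v)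
  lineEdge-ends {u = u} {v} (_ , _ , u≢v) with Finₚ.<-cmp u v
  ... | tri< _ _ _   = inj₁ (refl , refl)
  ... | tri≈ _ u≡v _ = ⊥-elim (u≢v u≡v)
  ... | tri> _ _ _   = inj₂ (refl , refl)

  lineEdge-triangle : ∀ {w u v} (side : Side (tri w) u v) → lineTriangle (lineEdge side) ≡ w
  lineEdge-triangle {u = u} {v} (_ , _ , u≢v) with Finₚ.<-cmp u v
  ... | tri< _ _ _   = refl
  ... | tri≈ _ u≡v _ = ⊥-elim (u≢v u≡v)
  ... | tri> _ _ _   = refl

  triangleOf : Edge → Fin t
  triangleOf e = index (proj₁ (tp e))

  ∈-triangleOf : ∀ e → InTriangle J e (tri (triangleOf e))
  ∈-triangleOf e = subst (InTriangle J e) (sym (tri-index (proj₁ (tp e)))) (proj₂ (tp e))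

  triangleOf-unique : ∀ {e w} → InTriangle J e (tri w) → triangleOf e ≡ w
  triangleOf-unique {e} {w} e∈w =
    trans (cong index (edge-unique {T = proj₁ (tp e)} (proj₂ (tp e)) e∈w)) (Inverse.strictlyInverseʳ enum w)

  endsSide : ∀ e → Side (tri (triangleOf e)) (proj₁ (ends J e)) (proj₂ (ends J e))
  endsSide e = triangle-edge-ends (tri (triangleOf e)) (∈-triangleOf e) (inj₁ refl)

  toLine : Edge → LineEdge
  toLine e = lineEdge (endsSide e)

  toLine-ends : ∀ e → SamePair (lineEnds (toLine e)) (ends J e)
  toLine-ends e = lineEdge-ends (endsSide e)

  fromLine : LineEdge → Edge
  fromLine r = proj₁ (triangle-edge (tri (lineTriangle r)) (lineSide r))

  fromLine-∈ : ∀ r → InTriangle J (fromLine r) (tri (lineTriangle r))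
  fromLine-∈ r = proj₁ (proj₂ (triangle-edge (tri (lineTriangle r)) (lineSide r)))

  fromLine-Joins : ∀ r → Joins J (fromLine r) (proj₁ (lineEnds r)) (proj₂ (lineEnds r))
  fromLine-Joins r = proj₂ (proj₂ (triangle-edge (tri (lineTriangle r)) (lineSide r)))

  fromLine-toLine : ∀ e → fromLine (toLine e) ≡ e
  fromLine-toLine e = triangle-edge-unique (tri (triangleOf e)) f∈ (∈-triangleOf e)
    (Joins-SamePair (fromLine-Joins r) (toLine-ends e)) (inj₁ refl)
    where
    r = toLine e
    f∈ : InTriangle J (fromLine r) (tri (triangleOf e))
    f∈ = subst (λ w → InTriangle J (fromLine r) (tri w)) (lineEdge-triangle (endsSide e)) (fromLine-∈ r)

  toLine-fromLine : ∀ r → toLine (fromLine r) ≡ r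
  toLine-fromLine r = LineEdge-ext (cong₂ _,_ (proj₁ same-ends) (proj₂ same-ends)) same-triangle
    where
    f = fromLine r
    same-ends = SamePair-sorted (lineEnds-sorted (toLine f)) (lineEnds-sorted r)
                  (SamePair-trans (toLine-ends f) (Joins⇒SamePair (inj₁ refl) (fromLine-Joins r)))
    same-triangle : lineTriangle (toLine f) ≡ lineTriangle r
    same-triangle = trans (lineEdge-triangle (endsSide f)) (triangleOf-unique (fromLine-∈ r))

  J≅LineGraph-H : Isomorphic (toGraph J) (LineGraph H)
  J≅LineGraph-H = ↔-id _ , mk↔ₛ′ toLine fromLine toLine-fromLine fromLine-toLine , toLine-ends

corollary1 : (J : FinGraph) → Regular 4 J → TriangleProperty J →
    (t : ℕ) → NumTriangles J t → 6 * t ≡ 4 * n J →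
    Σ[ H ∈ FinGraph ] (Loopless H × Regular 3 H × TriangleFree H ×
      Isomorphic (toGraph J) (LineGraph H))
corollary1 J reg tp t enum 6t≡4n = H , H-loopless , H-cubic , H-triangleFree , J≅LineGraph-H
  where
  open TriangleCounts J enum
  edge-once : ∀ e → triangleCount e ≡ 1
  edge-once = optimal⇒triangleCount≡1 reg tp 6t≡4n
  vertex-twice : ∀ v → vertexTriangleCount v ≡ 2
  vertex-twice v = *-cancelˡ-≡ _ 2 2 (trans (triangleCount≡1⇒2*vertexTriangleCount≡degree edge-once v) (reg v))
  open TriangleLineGraph J enum tp edge-once vertex-twice
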